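{- The reachable points of a Dyck N-walk $w$ are $$\left\{\min(w)+2i\ :\ i\in\left\{0,\dots,\tfrac{\max(w)-\min(w)}{2}\right\}\right\}.$$ The same holds for Dyck N-meanders, with $\min(w)$ and $\max(w)$ replaced by $\min^+(w)$ and $\max^+(w)$.
   Context: An N-step is a non-empty finite set of integers. Dyck N-walks are finite sequences $w=(s_1,\dots,s_n)$ of N-steps from $\{\{ -1\},\{1\},\{ -1,1\}\}$, starting at $0$. A classical walk $(v_1,\dots,v_n)$ with positions $\omega_k=\sum_{i\le k}v_i$ is compatible with $w$ if $v_i\in s_i$ for all $i$; it is a meander if all $\omega_k\ge0$. The reachable points of an N-walk are the endpoints $\omega_n$ of all compatible walks, with minimum $\min(w)$ and maximum $\max(w)$. An N-meander is an N-walk compatible with at least one meander; its reachable points are the endpoints of all compatible meanders, with minimum $\min^+(w)$ and maximum $\max^+(w)$. -}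

module Defs where

open import Data.Integer using (ℤ; +_; -[1+_]; _+_; _≤_)
open import Data.List using (List; []; _∷_)
open import Relation.Binary.PropositionalEquality using (_≡_)
open import Data.List.Relation.Unary.All using (All)
open import Data.List.Relation.Binary.Pointwise using (Pointwise)
open import Data.Product using (Σ; _×_; ∃)

-- The three Dyck N-steps {-1}, {1}, {-1,1}
data DyckStep : Set where
  dn up both : DyckStep

minus1 : ℤ
minus1 = -[1+ 0 ]

data _∈ₛ_ : ℤ → DyckStep → Set where
  dn∈dn     : minus1 ∈ₛ dn
  up∈up     : (+ 1) ∈ₛ up
  dn∈both   : minus1 ∈ₛ both
  up∈both   : (+ 1) ∈ₛ both

DyckNWalk : Set
DyckNWalk = List DyckStep

Compatible : DyckNWalk → List ℤ → Set
Compatible w v = Pointwise _∈ₛ_ v w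

positionsFrom : ℤ → List ℤ → List ℤ
positionsFrom h []       = []
positionsFrom h (x ∷ xs) = (h + x) ∷ positionsFrom (h + x) xs

IsMeander : List ℤ → Set
IsMeander v = All (λ ω → + 0 ≤ ω) (positionsFrom (+ 0) v)

endpoint : List ℤ → ℤ
endpoint []       = + 0
endpoint (x ∷ xs) = x + endpoint xs

Reachable : DyckNWalk → ℤ → Set
Reachable w x = ∃ λ v → Compatible w v × endpoint v ≡ x

ReachableMeander : DyckNWalk → ℤ → Set
ReachableMeander w x = ∃ λ v → Compatible w v × IsMeander v × endpoint v ≡ x

IsNMeander : DyckNWalk → Set
IsNMeander w = ∃ λ v → Compatible w v × IsMeander v

IsMinimum : (ℤ → Set) → ℤ → Set
IsMinimum P m = P m × (∀ x → P x → m ≤ x)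

IsMaximum : (ℤ → Set) → ℤ → Set
IsMaximum P m = P m × (∀ x → P x → x ≤ m)

{-# OPTIONS --safe #-}
-- Every endpoint of a walk compatible with w has the parity of length w, so reachable points are
-- spaced by multiples of 2. Gaps are filled by an exchange argument: given compatible walks ending
-- at x and at y ≥ x + 2, follow them to the first step where they choose differently, necessarily
-- at a step {-1,1}. If the walk to x goes down there, switching it to up raises its remainder by 2
-- and reaches x + 2. Otherwise switching the walk to y to up makes it end at y + 2 and agree with
-- the walk to x one step longer. Raising positions never breaks nonnegativity, so the argument
-- works verbatim for meanders. Iterating from the minimum reaches every mn + 2i up to the maximum.
module Submission where

open import Defs
open import Data.Integer using (ℤ; +_; -[1+_]; -1ℤ; _+_; _*_; -_; _≤_; _<_; +<+)
import Data.Integer.Properties as ℤP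
open import Data.Integer.Tactic.RingSolver using (solve-∀)
open import Data.Nat as ℕ using (ℕ; zero; suc; s≤s; z≤n)
import Data.Nat.Properties as ℕP
open import Data.List using ([]; _∷_; length; map)
open import Data.List.Relation.Unary.All using (All; []; _∷_; universal-U)
import Data.List.Relation.Unary.All as All
open import Data.List.Relation.Unary.All.Properties using (map⁺)
open import Data.List.Relation.Binary.Pointwise using ([]; _∷_)
open import Data.Product using (_×_; ∃; _,_)
open import Data.Unit using (tt)
open import Data.Empty using (⊥-elim)
open import Level using (0ℓ)
open import Function.Base using (_∘_)
open import Function.Bundles using (_⇔_; mk⇔)
open import Relation.Binary.PropositionalEquality
  using (_≡_; refl; sym; trans; cong; cong₂; subst; subst₂; module ≡-Reasoning)
open import Relation.Unary using (Pred; U; _≐_)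

variable
  a b h t x y mn mx : ℤ
  n : ℕ
  s : DyckStep
  w : DyckNWalk
  P P′ : Pred ℤ 0ℓ

infix 4 _∈_+2ℕ

_∈_+2ℕ : ℤ → ℤ → Set
y ∈ x +2ℕ = ∃ λ i → y ≡ x + + 2 * + i

+2*suc : ∀ x i → x + + 2 * + suc i ≡ (x + + 2 * + i) + + 2
+2*suc x i = trans (cong (λ k → x + + 2 * k) (ℤP.pos-+ 1 i)) (ring x (+ i))
  where
  ring : ∀ x k → x + + 2 * (+ 1 + k) ≡ (x + + 2 * k) + + 2
  ring = solve-∀

+-cancelˡ-≤ : ∀ t → t + a ≤ t + b → a ≤ b
+-cancelˡ-≤ {a} {b} t = subst₂ _≤_ (ring t a) (ring t b) ∘ ℤP.+-monoʳ-≤ (- t)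
  where
  ring : ∀ t a → - t + (t + a) ≡ a
  ring = solve-∀

i<i+2 : ∀ i → i < i + + 2
i<i+2 i = subst (_< i + + 2) (ℤP.+-identityʳ i) (ℤP.+-monoʳ-< i (+<+ (s≤s z≤n)))

∈+2ℕ-translate : ∀ h → y ∈ x +2ℕ → h + y ∈ h + x +2ℕ
∈+2ℕ-translate {x = x} h (i , refl) = i , sym (ℤP.+-assoc h x (+ 2 * + i))

∈+2ℕ-gap : x ∈ t +2ℕ → y ∈ t +2ℕ → x ≤ y → y ∈ x +2ℕ
∈+2ℕ-gap {t = t} (j , refl) (k , refl) x≤y with ℕP.m≤n⇒∃[o]m+o≡n j≤k
  where
  j≤k : j ℕ.≤ k
  j≤k = ℤP.drop‿+≤+ (ℤP.*-cancelˡ-≤-pos (+ j) (+ k) (+ 2) (+-cancelˡ-≤ t x≤y))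
... | i , refl = i , trans (cong (λ m → t + + 2 * m) (ℤP.pos-+ j i)) (ring t (+ j) (+ i))
  where
  ring : ∀ t a b → t + + 2 * (a + b) ≡ (t + + 2 * a) + + 2 * b
  ring = solve-∀

∈+2ℕ-down : a ∈ - + n +2ℕ → minus1 + a ∈ - + suc n +2ℕ
∈+2ℕ-down {n = n} (j , refl) =
  j , trans (sym (ℤP.+-assoc minus1 (- + n) _)) (cong (_+ + 2 * + j) (sym (ℤP.neg-suc n)))

∈+2ℕ-up : a ∈ - + n +2ℕ → + 1 + a ∈ - + suc n +2ℕ
∈+2ℕ-up {n = n} (j , refl) = suc j , (begin
  + 1 + (- + n + + 2 * + j)            ≡⟨ ring (- + n) (+ 2 * + j) ⟩
  (-1ℤ + - + n + + 2 * + j) + + 2      ≡⟨ cong (λ m → (m + + 2 * + j) + + 2) (sym (ℤP.neg-suc n)) ⟩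
  (-[1+ n ] + + 2 * + j) + + 2         ≡⟨ sym (+2*suc -[1+ n ] j) ⟩
  -[1+ n ] + + 2 * + suc j             ∎)
  where
  open ≡-Reasoning
  ring : ∀ m k → + 1 + (m + k) ≡ (-1ℤ + m + k) + + 2
  ring = solve-∀

compatible-endpoint : ∀ {v} → Compatible w v → endpoint v ∈ - + length w +2ℕ
compatible-endpoint []              = 0 , refl
compatible-endpoint (dn∈dn   ∷ c) = ∈+2ℕ-down (compatible-endpoint c)
compatible-endpoint (dn∈both ∷ c) = ∈+2ℕ-down (compatible-endpoint c)
compatible-endpoint (up∈up   ∷ c) = ∈+2ℕ-up (compatible-endpoint c)
compatible-endpoint (up∈both ∷ c) = ∈+2ℕ-up (compatible-endpoint c)

positionsFrom-+ : ∀ h d v → positionsFrom (h + d) v ≡ map (_+ d) (positionsFrom h v)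
positionsFrom-+ h d []      = refl
positionsFrom-+ h d (a ∷ v) =
  cong₂ _∷_ swap (trans (cong (λ k → positionsFrom k v) swap) (positionsFrom-+ (h + a) d v))
  where
  ring : ∀ h d a → (h + d) + a ≡ (h + a) + d
  ring = solve-∀
  swap : (h + d) + a ≡ (h + a) + d
  swap = ring h d a

data ChoicePair : ℤ → ℤ → Set where
  same    : ChoicePair a a
  down-up : ChoicePair minus1 (+ 1)
  up-down : ChoicePair (+ 1) minus1

choicePair : a ∈ₛ s → b ∈ₛ s → ChoicePair a b
choicePair dn∈dn   dn∈dn   = same
choicePair up∈up   up∈up   = same
choicePair dn∈both dn∈both = same
choicePair dn∈both up∈both = down-up
choicePair up∈both dn∈both = up-down
choicePair up∈both up∈both = same

EvenlySpaced : Pred ℤ 0ℓ → Set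
EvenlySpaced P = ∀ {x y} → P x → P y → x ≤ y → y ∈ x +2ℕ

GapClosed : Pred ℤ 0ℓ → Set
GapClosed P = ∀ {x y} → P x → P y → x + + 2 ≤ y → P (x + + 2)

EvenlySpaced-resp-≐ : P ≐ P′ → EvenlySpaced P → EvenlySpaced P′
EvenlySpaced-resp-≐ (_ , P′⊆P) spaced px py = spaced (P′⊆P px) (P′⊆P py)

GapClosed-resp-≐ : P ≐ P′ → GapClosed P → GapClosed P′
GapClosed-resp-≐ (P⊆P′ , P′⊆P) closed px py = P⊆P′ ∘ closed (P′⊆P px) (P′⊆P py)

GapClosed⇒progression : GapClosed P → P x → P y →
                         ∀ i → x + + 2 * + i ≤ y → P (x + + 2 * + i)
GapClosed⇒progression {P = P} {x = x} closed px py zero    _  =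
  subst P (sym (ℤP.+-identityʳ x)) px
GapClosed⇒progression {P = P} {x = x} {y = y} closed px py (suc i) le =
  subst P (sym (+2*suc x i)) (closed (GapClosed⇒progression closed px py i le′) py le″)
  where
  le″ : (x + + 2 * + i) + + 2 ≤ y
  le″ = subst (_≤ y) (+2*suc x i) le
  le′ : x + + 2 * + i ≤ y
  le′ = ℤP.≤-trans (ℤP.i≤i+j _ (+ 2)) le″

progression-between-extrema :
  EvenlySpaced P → GapClosed P → IsMinimum P mn → IsMaximum P mx →
  ∀ x → P x ⇔ (∃ λ (i : ℕ) → (mn + (+ 2) * (+ i) ≤ mx) × x ≡ mn + (+ 2) * (+ i))
progression-between-extrema {P = P} {mn = mn} {mx = mx} spaced closed (pmn , least) (pmx , greatest) x =
  mk⇔ to from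
  where
  to : P x → ∃ λ i → (mn + + 2 * + i ≤ mx) × x ≡ mn + + 2 * + i
  to px with spaced pmn px (least x px)
  ... | i , x≡ = i , subst (_≤ mx) x≡ (greatest x px) , x≡
  from : (∃ λ i → (mn + + 2 * + i ≤ mx) × x ≡ mn + + 2 * + i) → P x
  from (i , le , refl) = GapClosed⇒progression closed pmn pmx i le

module Constrained (Q : Pred ℤ 0ℓ) (Q-+2 : ∀ {p} → Q p → Q (p + + 2)) where

  ReachableFrom : ℤ → DyckNWalk → ℤ → Set
  ReachableFrom h w x =
    ∃ λ v → Compatible w v × All Q (positionsFrom h v) × h + endpoint v ≡ x

  ReachableFrom-∷⁺ : a ∈ₛ s → Q (h + a) → ReachableFrom (h + a) w x → ReachableFrom h (s ∷ w) x
  ReachableFrom-∷⁺ {a = a} {h = h} a∈s qa (v , c , qs , refl) =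
    a ∷ v , a∈s ∷ c , qa ∷ qs , sym (ℤP.+-assoc h a (endpoint v))

  ReachableFrom-∷⁻ : ReachableFrom h (s ∷ w) x →
                     ∃ λ a → a ∈ₛ s × Q (h + a) × ReachableFrom (h + a) w x
  ReachableFrom-∷⁻ {h = h} (a ∷ v , a∈s ∷ c , qa ∷ qs , refl) =
    a , a∈s , qa , v , c , qs , ℤP.+-assoc h a (endpoint v)

  raise : ReachableFrom h w x → ReachableFrom (h + + 2) w (x + + 2)
  raise {h = h} (v , c , qs , refl) =
    v , c , subst (All Q) (sym (positionsFrom-+ h (+ 2) v)) (map⁺ (All.map Q-+2 qs)) ,
    ring h (endpoint v)
    where
    ring : ∀ h e → (h + + 2) + e ≡ (h + e) + + 2
    ring = solve-∀

  raise-down-to-up : ReachableFrom (h + minus1) w x → ReachableFrom (h + + 1) w (x + + 2)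
  raise-down-to-up {h = h} {w = w} =
    subst (λ k → ReachableFrom k w _) (ℤP.+-assoc h minus1 (+ 2)) ∘ raise

  ReachableFrom-∈+2ℕ : ReachableFrom h w x → x ∈ h + - + length w +2ℕ
  ReachableFrom-∈+2ℕ {h = h} (v , c , _ , refl) = ∈+2ℕ-translate h (compatible-endpoint c)

  evenlySpaced : EvenlySpaced (ReachableFrom h w)
  evenlySpaced {h = h} {w = w} rx ry =
    ∈+2ℕ-gap {t = h + - + length w} (ReachableFrom-∈+2ℕ rx) (ReachableFrom-∈+2ℕ ry)

  gapClosed : ∀ w → GapClosed (ReachableFrom h w)
  gapClosed [] ([] , [] , [] , refl) ([] , [] , [] , refl) x+2≤x =
    ⊥-elim (ℤP.≤⇒≯ x+2≤x (i<i+2 _))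
  gapClosed {h = h} (s ∷ w) rx ry x+2≤y with ReachableFrom-∷⁻ rx | ReachableFrom-∷⁻ ry
  ... | a , a∈s , qa , rx′ | b , b∈s , qb , ry′ with choicePair a∈s b∈s
  ... | same    = ReachableFrom-∷⁺ {h = h} a∈s qa (gapClosed w rx′ ry′ x+2≤y)
  ... | down-up = ReachableFrom-∷⁺ {h = h} b∈s qb (raise-down-to-up {h = h} rx′)
  ... | up-down = ReachableFrom-∷⁺ {h = h} a∈s qa
                    (gapClosed w rx′ (raise-down-to-up {h = h} ry′)
                      (ℤP.≤-trans x+2≤y (ℤP.i≤i+j _ (+ 2))))

module Walks = Constrained U (λ _ → tt)

module Meanders = Constrained (+ 0 ≤_) (λ {p} 0≤p → ℤP.≤-trans 0≤p (ℤP.i≤i+j p (+ 2)))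

walks≐reachable : Walks.ReachableFrom (+ 0) w ≐ Reachable w
walks≐reachable = to , from
  where
  to : Walks.ReachableFrom (+ 0) w x → Reachable w x
  to (v , c , _ , e) = v , c , trans (sym (ℤP.+-identityˡ _)) e
  from : Reachable w x → Walks.ReachableFrom (+ 0) w x
  from (v , c , e) = v , c , universal-U _ , trans (ℤP.+-identityˡ _) e

meanders≐reachableMeander : Meanders.ReachableFrom (+ 0) w ≐ ReachableMeander w
meanders≐reachableMeander = to , from
  where
  to : Meanders.ReachableFrom (+ 0) w x → ReachableMeander w x
  to (v , c , m , e) = v , c , m , trans (sym (ℤP.+-identityˡ _)) e
  from : ReachableMeander w x → Meanders.ReachableFrom (+ 0) w x
  from (v , c , m , e) = v , c , m , trans (ℤP.+-identityˡ _) e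

lemma2p1 :
    ((w : DyckNWalk) (mn mx : ℤ) →
      IsMinimum (Reachable w) mn → IsMaximum (Reachable w) mx →
      ∀ x → Reachable w x ⇔ (∃ λ (i : ℕ) → (mn + (+ 2) * (+ i) ≤ mx) × x ≡ mn + (+ 2) * (+ i)))
    ×
    ((w : DyckNWalk) → IsNMeander w → (mn mx : ℤ) →
      IsMinimum (ReachableMeander w) mn → IsMaximum (ReachableMeander w) mx →
      ∀ x → ReachableMeander w x ⇔ (∃ λ (i : ℕ) → (mn + (+ 2) * (+ i) ≤ mx) × x ≡ mn + (+ 2) * (+ i)))
lemma2p1 =
  (λ w _ _ → progression-between-extrema
     (EvenlySpaced-resp-≐ walks≐reachable Walks.evenlySpaced)
     (GapClosed-resp-≐ walks≐reachable (Walks.gapClosed w))) ,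
  -- IsNMeander w only guarantees that the extrema exist, and they are given.
  (λ w _ _ _ → progression-between-extrema
     (EvenlySpaced-resp-≐ meanders≐reachableMeander Meanders.evenlySpaced)
     (GapClosed-resp-≐ meanders≐reachableMeander (Meanders.gapClosed w)))
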